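{- Let $w$ be a nonempty string and let $\mathit{LFCand}(w) = \{x \in \mathit{Suffix}(w) \mid \exists y\in\Sigma^+ \text{ such that } xy = \min_\prec \mathit{Suffix}(wy)\}$. For any two strings $u,v\in \mathit{LFCand}(w)$ with $|u|<|v|$, $u$ is a prefix of $v$.
   Context: Strings are over a finite totally ordered alphabet $\Sigma$; $\Sigma^+$ is the set of nonempty strings. $\mathit{Suffix}(w)$ is the set of suffixes of $w$. For nonempty strings $x,y$, let $\mathit{lcp}(x,y)$ be the length of their longest common prefix; $x \prec y$ means either $x[\mathit{lcp}(x,y)+1] \prec y[\mathit{lcp}(x,y)+1]$ or $x$ is a proper prefix of $y$. For a set $S$ of nonempty strings, $\min_\prec S$ is the lexicographically smallest element of $S$. -}

module Defs where

open import Level using (Level)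
open import Data.Empty using (⊥)
open import Data.Product using (Σ; ∃; _×_; _,_)
open import Data.List using (List; []; _∷_; _++_; length)
open import Data.List.Membership.Propositional using (_∈_)
open import Data.List.Relation.Binary.Lex.Core using (Lex-<)
open import Data.Sum using (_⊎_)
open import Data.Nat using (_≥_)
open import Relation.Binary.Structures using (IsStrictTotalOrder)
open import Relation.Binary.PropositionalEquality using (_≡_)

-- A finite totally ordered alphabet Σ: a strict total order (w.r.t. ≡)
-- on a carrier, together with a list enumerating every letter (finiteness).
record Alphabet : Set₁ where
  field
    Carrier  : Set
    _<ₐ_     : Carrier → Carrier → Set
    isSTO    : IsStrictTotalOrder _≡_ _<ₐ_
    letters  : List Carrier
    complete : ∀ a → a ∈ letters

module Strings (Σ' : Alphabet) where
  open Alphabet Σ'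

  String : Set
  String = List Carrier

  NonEmpty : String → Set
  NonEmpty s = length s ≥ 1

  IsSuffix : String → String → Set
  IsSuffix x w = ∃ λ z → z ++ x ≡ w

  IsPrefix : String → String → Set
  IsPrefix x w = ∃ λ z → x ++ z ≡ w

  -- strict lexicographic order: x ≺ y iff the first differing letter is
  -- smaller in x, or x is a proper prefix of y.
  _≺_ : String → String → Set
  _≺_ = Lex-< _≡_ _<ₐ_

  -- Suffix(w): the nonempty suffixes of w (strings are nonempty by convention)
  InSuffix : String → String → Set
  InSuffix x w = NonEmpty x × IsSuffix x w

  IsMinSuffix : String → String → Set
  IsMinSuffix m w = InSuffix m w × (∀ s → InSuffix s w → m ≡ s ⊎ m ≺ s)

  LFCand : String → String → Set
  LFCand w x = InSuffix x w × ∃ λ y → NonEmpty y × IsMinSuffix (x ++ y) (w ++ y)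

-- Let u, v ∈ LFCand(w) with |u| < |v|, witnessed by y and y′. Both u and v
-- are suffixes of w, so v y is a suffix of w y other than u y, and u y′ is a
-- suffix of w y′ other than v y′; minimality gives u y ≺ v y and v y′ ≺ u y′.
-- If u were not a prefix of v, they would differ at a position within u, and
-- that single mismatch would decide both comparisons in opposite directions.
module Submission where

open import Defs
open import Data.List using ([]; _∷_; _++_; length)
open import Data.List.Properties using (++-assoc; length-++; ++-cancelʳ)
open import Data.List.Relation.Binary.Lex.Core using (this; next)
open import Data.Nat using (_<_; _≤_; s≤s)
open import Data.Nat.Properties using (<⇒≢; <⇒≤; ≤-trans; m≤m+n; ≤-reflexive)
open import Data.Product using (_,_)
open import Data.Sum using (inj₁; inj₂)
open import Data.Empty using (⊥-elim)
open import Relation.Binary.PropositionalEquality using (_≢_; ≢-sym; refl; cong; sym; trans)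
open import Relation.Binary.Structures using (IsStrictTotalOrder)

module _ (Σ' : Alphabet) where
  open Alphabet Σ'
  open Strings Σ'
  open IsStrictTotalOrder isSTO using (irrefl) renaming (trans to <ₐ-trans)

  prefix-of-≺-both-ways : ∀ u v a b c d → length u ≤ length v →
    (u ++ a) ≺ (v ++ b) → (v ++ c) ≺ (u ++ d) → IsPrefix u v
  prefix-of-≺-both-ways []      v       a b c d _ _ _ = v , refl
  prefix-of-≺-both-ways (x ∷ u) (y ∷ v) a b c d _ (this x<y) (this y<x) =
    ⊥-elim (irrefl refl (<ₐ-trans x<y y<x))
  prefix-of-≺-both-ways (x ∷ u) (y ∷ v) a b c d _ (this x<y) (next y≡x _) =
    ⊥-elim (irrefl (sym y≡x) x<y)
  prefix-of-≺-both-ways (x ∷ u) (y ∷ v) a b c d _ (next x≡y _) (this y<x) =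
    ⊥-elim (irrefl (sym x≡y) y<x)
  prefix-of-≺-both-ways (x ∷ u) (y ∷ v) a b c d (s≤s |u|≤|v|) (next refl p) (next _ q)
    with z , u++z≡v ← prefix-of-≺-both-ways u v a b c d |u|≤|v| p q = z , cong (x ∷_) u++z≡v

  InSuffix-++ʳ : ∀ {x w} y → InSuffix x w → InSuffix (x ++ y) (w ++ y)
  InSuffix-++ʳ {x} y (1≤|x| , z , z++x≡w) =
    ≤-trans 1≤|x| (≤-trans (m≤m+n (length x) (length y)) (≤-reflexive (sym (length-++ x)))) ,
    z , trans (sym (++-assoc z x y)) (cong (_++ y) z++x≡w)

  ++ʳ-≢-of-length-≢ : ∀ u v y → length u ≢ length v → u ++ y ≢ v ++ y
  ++ʳ-≢-of-length-≢ u v y |u|≢|v| eq = |u|≢|v| (cong length (++-cancelʳ {A = Carrier} y u v eq))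

  IsMinSuffix-++ʳ-≺ : ∀ {w} x s y → length x ≢ length s →
    IsMinSuffix (x ++ y) (w ++ y) → InSuffix s w → (x ++ y) ≺ (s ++ y)
  IsMinSuffix-++ʳ-≺ x s y |x|≢|s| (_ , minimal) s∈w with minimal (s ++ y) (InSuffix-++ʳ y s∈w)
  ... | inj₁ eq = ⊥-elim (++ʳ-≢-of-length-≢ x s y |x|≢|s| eq)
  ... | inj₂ lt = lt

lemma4 : (Σ' : Alphabet) → let open Strings Σ' in
    (w : String) → NonEmpty w →
    (u v : String) → LFCand w u → LFCand w v →
    length u < length v → IsPrefix u v
lemma4 Σ' w _ u v (u∈w , y , _ , uy-min) (v∈w , y′ , _ , vy′-min) |u|<|v| =
  prefix-of-≺-both-ways Σ' u v y y y′ y′ (<⇒≤ |u|<|v|)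
    (IsMinSuffix-++ʳ-≺ Σ' u v y (<⇒≢ |u|<|v|) uy-min v∈w)
    (IsMinSuffix-++ʳ-≺ Σ' v u y′ (≢-sym (<⇒≢ |u|<|v|)) vy′-min u∈w)
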